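{- Let $A,B$ be models. (1) If $A$ and $B$ are isomorphic, then they are strongly equivalent. (2) If $A$ and $B$ are both complete and strongly equivalent, then they are isomorphic.
   Context: A model of computation over a set $X$ is any set of functions $f:X\to X\cup\{\bot\}$, where $\bot$ denotes "undefined". Injections are extended by $\rho(\bot)=\bot$. $A\succsim_\rho B$ means: for every $g\in B$ there is $f\in A$ with $\rho\circ g=f\circ\rho$; $A\succsim B$ means $A\succsim_\rho B$ for some injection $\rho$. $A$ and $B$ are strongly equivalent if there are bijections $\pi,\tau$ with $A\succsim_\pi B$ and $B\succsim_\tau A$. They are isomorphic if there is a bijection $\pi:\mathrm{dom}\,B\to\mathrm{dom}\,A$ with $A\succsim_\pi B$ and $B\succsim_{\pi^{ -1}}A$. A model $A$ is complete if for every model $M$ over $\mathrm{dom}\,A$ with $M\supseteq A$ and $A\succsim M$, we have $M=A$. -}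

module Defs where

open import Data.Maybe using (Maybe; just; nothing; map)
open import Data.Product using (Σ; _×_; _,_; ∃)
open import Function using (_∘_)
open import Function.Bundles using (_↣_; _⤖_; _↔_; Injection; Bijection; Inverse)
open import Relation.Binary.PropositionalEquality using (_≡_)

-- A model of computation over a set X: a set of partial functions
-- X → X ∪ {⊥}, with ⊥ represented by 'nothing'.  The set of functions
-- is represented by a predicate (membership).
record Model : Set₁ where
  field
    dom : Set
    funs : (dom → Maybe dom) → Set
open Model public

Fn : Model → Set
Fn A = dom A → Maybe (dom A)

ext : {X Y : Set} → (X → Y) → Maybe X → Maybe Y
ext ρ = map ρ

Sim : (A B : Model) → (dom B → dom A) → Set
Sim A B ρ = (g : Fn B) → funs B g →
  Σ (Fn A) λ f → funs A f × ((x : dom B) → ext ρ (g x) ≡ f (ρ x))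

_≿_ : Model → Model → Set
A ≿ B = Σ (dom B ↣ dom A) λ ρ → Sim A B (Injection.to ρ)

StronglyEquivalent : Model → Model → Set
StronglyEquivalent A B =
  Σ (dom B ⤖ dom A) λ π → Σ (dom A ⤖ dom B) λ τ →
    Sim A B (Bijection.to π) × Sim B A (Bijection.to τ)

Isomorphic : Model → Model → Set
Isomorphic A B =
  Σ (dom B ↔ dom A) λ π →
    Sim A B (Inverse.to π) × Sim B A (Inverse.from π)

Complete : Model → Set₁
Complete A =
  (M : Fn A → Set) →
  ((f : Fn A) → funs A f → M f) →
  A ≿ record { dom = dom A ; funs = M } →
  (f : Fn A) → M f → funs A f

-- Let π : dom B → dom A and τ : dom A → dom B be the bijections and
-- adjoin to B every conjugate π⁻¹ ∘ f ∘ π of an f ∈ A.  B simulates itself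
-- along τ ∘ π (passing through A), and it simulates each conjugate along
-- τ ∘ π as well, because π turns the conjugate back into f.  So the enlarged
-- model is simulated by B along an injection, and completeness of B forces
-- all conjugates to lie in B already; that is precisely B ≿_{π⁻¹} A.
module Submission where

open import Defs
open import Data.Product using (_×_; Σ; _,_)
open import Data.Sum using (_⊎_; inj₁; inj₂)
open import Data.Maybe using (Maybe)
open import Data.Maybe.Properties using (map-∘; map-cong; map-id)
open import Function using (_∘_)
open import Function.Bundles using (_↣_; _↔_; Injection; Bijection; Inverse)
open import Function.Properties.Inverse using (↔⇒⤖)
open import Function.Properties.Bijection using (⤖⇒↔)
open import Function.Construct.Composition using (_↣-∘_)
open import Function.Construct.Symmetry using (↔-sym)
open import Relation.Binary.PropositionalEquality using (_≡_; refl; sym; cong; module ≡-Reasoning)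

modelOver : (X : Set) → ((X → Maybe X) → Set) → Model
modelOver X P = record { dom = X ; funs = P }

_∪_ : (B : Model) → (Fn B → Set) → Model
B ∪ P = modelOver (dom B) (λ g → funs B g ⊎ P g)

Conjugates : (A : Model) {Y : Set} → (Y → dom A) → (dom A → Y) → (Y → Maybe Y) → Set
Conjugates A p q g = Σ (Fn A) λ f → funs A f × (∀ y → g y ≡ ext q (f (p y)))

Sim-∘ : {A B C : Model} {ρ : dom B → dom A} {σ : dom C → dom B} →
  Sim A B ρ → Sim B C σ → Sim A C (ρ ∘ σ)
Sim-∘ {ρ = ρ} {σ} simAB simBC g gC with simBC g gC
... | h , hB , σg≡hσ with simAB h hB
...   | f , fA , ρh≡fρ = f , fA , λ x → begin
  ext (ρ ∘ σ) (g x)      ≡⟨ map-∘ (g x) ⟩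
  ext ρ (ext σ (g x))    ≡⟨ cong (ext ρ) (σg≡hσ x) ⟩
  ext ρ (h (σ x))        ≡⟨ ρh≡fρ (σ x) ⟩
  f (ρ (σ x))            ∎
  where open ≡-Reasoning

Sim-∪ : {A B : Model} {P : Fn B → Set} {ρ : dom B → dom A} →
  Sim A B ρ → Sim A (modelOver (dom B) P) ρ → Sim A (B ∪ P) ρ
Sim-∪ simB simP g (inj₁ gB) = simB g gB
Sim-∪ simB simP g (inj₂ gP) = simP g gP

Sim-Conjugates : {A : Model} {Y : Set} {p : Y → dom A} {q : dom A → Y} →
  (∀ x → p (q x) ≡ x) → Sim A (modelOver Y (Conjugates A p q)) p
Sim-Conjugates {p = p} {q} pq≗id g (f , fA , g≡qfp) = f , fA , λ y → begin
  ext p (g y)                  ≡⟨ cong (ext p) (g≡qfp y) ⟩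
  ext p (ext q (f (p y)))      ≡⟨ map-∘ (f (p y)) ⟨
  ext (p ∘ q) (f (p y))        ≡⟨ map-cong pq≗id (f (p y)) ⟩
  ext (λ x → x) (f (p y))      ≡⟨ map-id (f (p y)) ⟩
  f (p y)                      ∎
  where open ≡-Reasoning

Sim-of-Conjugates⊆ : {A B : Model} {p : dom B → dom A} {q : dom A → dom B} →
  (∀ x → p (q x) ≡ x) → (∀ g → Conjugates A p q g → funs B g) → Sim B A q
Sim-of-Conjugates⊆ {p = p} {q} pq≗id conj⊆B f fA =
  ext q ∘ f ∘ p , conj⊆B _ (f , fA , λ _ → refl) , λ x → cong (ext q ∘ f) (sym (pq≗id x))

Complete⇒absorbs : {B : Model} → Complete B → (ρ : dom B ↣ dom B) →
  Sim B B (Injection.to ρ) → {P : Fn B → Set} →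
  Sim B (modelOver (dom B) P) (Injection.to ρ) → ∀ g → P g → funs B g
Complete⇒absorbs complete ρ simB simP g gP =
  complete _ (λ _ → inj₁) (ρ , Sim-∪ simB simP) g (inj₂ gP)

Isomorphic⇒StronglyEquivalent : (A B : Model) → Isomorphic A B → StronglyEquivalent A B
Isomorphic⇒StronglyEquivalent A B (π , simAB , simBA) = ↔⇒⤖ π , ↔⇒⤖ (↔-sym π) , simAB , simBA

StronglyEquivalent⇒Isomorphic : (A B : Model) → Complete B → StronglyEquivalent A B → Isomorphic A B
StronglyEquivalent⇒Isomorphic A B completeB (π , τ , simAB , simBA) =
  π↔ , simAB , Sim-of-Conjugates⊆ ππ⁻¹≗id conjugates⊆B
  where
  π↔ : dom B ↔ dom A
  π↔ = ⤖⇒↔ π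
  ππ⁻¹≗id : ∀ x → Inverse.to π↔ (Inverse.from π↔ x) ≡ x
  ππ⁻¹≗id = Inverse.strictlyInverseˡ π↔
  τπ : dom B ↣ dom B
  τπ = Bijection.injection τ ↣-∘ Bijection.injection π
  conjugates⊆B : ∀ g → Conjugates A (Inverse.to π↔) (Inverse.from π↔) g → funs B g
  conjugates⊆B = Complete⇒absorbs completeB τπ (Sim-∘ simBA simAB)
                   (Sim-∘ simBA (Sim-Conjugates ππ⁻¹≗id))

mainTheorem15 : (A B : Model) →
    (Isomorphic A B → StronglyEquivalent A B) ×
    (Complete A → Complete B → StronglyEquivalent A B → Isomorphic A B)
mainTheorem15 A B =
  Isomorphic⇒StronglyEquivalent A B ,
  λ _ completeB → StronglyEquivalent⇒Isomorphic A B completeB
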